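{- Let $q$ be a prime power, $F=\mathrm{GF}(q)$, $m\ge 2$, $n=\frac{q^m-1}{q-1}$, and let $\mathfrak{A}$, $R_\delta$ be as in the context. Let $\delta\in\mathfrak{A}$. Then every $\bar c\in R_\delta$ satisfies $$\sum_{\alpha\in L}c_\alpha\, l(\alpha)=0$$ for every linear function $l:F^m\to F$ with $l(\delta)=0$ and every line $L$ containing $\delta$.
   Context: $\mathfrak{A}\subset F^m$ is the set of nonzero vectors whose first nonzero entry equals $1$ (so $|\mathfrak{A}|=n$), and the coordinates of $F^n$ are indexed by $\mathfrak{A}$. A line is the intersection of $\mathfrak{A}$ with a $2$-dimensional linear subspace of $F^m$. The Hamming code is $\mathcal H_m=\{\bar c\in F^n\mid \sum_{\alpha\in\mathfrak{A}}c_\alpha\alpha=0^m\}$. For $\delta\in\mathfrak{A}$, $T_\delta$ is the set of $\bar c\in\mathcal H_m$ with exactly three nonzero coordinates and $c_\delta=1$, and $R_\delta$ is the linear span of $T_\delta$. -}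

module Defs where

open import Level using (0ℓ)
open import Data.Nat using (ℕ; zero; suc)
open import Data.Bool using (Bool; true; false; not; _∧_)
open import Data.List using (List; []; _∷_; [_]; map; concatMap; foldr; filterᵇ; length)
open import Data.Bool.ListAction using (any)
open import Data.Vec.Properties using (≡-dec)
open import Data.List.Membership.Propositional using (_∈_)
open import Data.List.Relation.Unary.Unique.Propositional using (Unique)
open import Data.Vec using (Vec; []; _∷_; zipWith; replicate)
import Data.Vec as Vec
open import Data.Product using (∃; _×_)
open import Relation.Binary.PropositionalEquality using (_≡_; _≢_)
open import Relation.Binary.Definitions using (DecidableEquality)
open import Relation.Nullary.Decidable using (⌊_⌋)
open import Algebra.Structures using (IsCommutativeRing)

-- A finite field, with propositional equality. Every finite field is GF(q)
-- for q = number of elements, a prime power, and conversely.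
record FiniteField : Set₁ where
  infixl 6 _+_
  infixl 7 _*_
  field
    Carrier  : Set
    _+_ _*_  : Carrier → Carrier → Carrier
    -_       : Carrier → Carrier
    0# 1#    : Carrier
    isCommutativeRing : IsCommutativeRing _≡_ _+_ _*_ -_ 0# 1#
    _≟_      : DecidableEquality Carrier
    0≢1      : 0# ≢ 1#
    inverse  : ∀ x → x ≢ 0# → ∃ λ y → x * y ≡ 1#
    elements : List Carrier
    elements-unique   : Unique elements
    elements-complete : ∀ x → x ∈ elements

module Hamming (𝔽 : FiniteField) where
  open FiniteField 𝔽

  Vector : ℕ → Set
  Vector m = Vec Carrier m

  _⊕_ : ∀ {m} → Vector m → Vector m → Vector m
  _⊕_ = zipWith _+_

  _·_ : ∀ {m} → Carrier → Vector m → Vector m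
  a · v = Vec.map (a *_) v

  0ᵛ : ∀ {m} → Vector m
  0ᵛ = replicate _ 0#

  allVecs : (m : ℕ) → List (Vector m)
  allVecs zero    = [ [] ]
  allVecs (suc m) = concatMap (λ x → map (x ∷_) (allVecs m)) elements

  -- α ∈ 𝔄 : α nonzero and its first nonzero entry equals 1
  inA : ∀ {m} → Vector m → Bool
  inA []      = false
  inA (x ∷ v) = ⌊ x ≟ 1# ⌋ Data.Bool.∨ (⌊ x ≟ 0# ⌋ ∧ inA v)

  -- enumeration of 𝔄 (|𝔄| = n = (q^m - 1)/(q - 1))
  𝔄 : (m : ℕ) → List (Vector m)
  𝔄 m = filterᵇ inA (allVecs m)

  -- vectors of F^n with coordinates indexed by 𝔄: only values on 𝔄 matter
  Word : ℕ → Set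
  Word m = Vector m → Carrier

  sumF : List Carrier → Carrier
  sumF = foldr _+_ 0#

  sumV : ∀ {m} → List (Vector m) → Vector m
  sumV = foldr _⊕_ 0ᵛ

  InHamming : ∀ {m} → Word m → Set
  InHamming {m} c = sumV (map (λ α → c α · α) (𝔄 m)) ≡ 0ᵛ

  weight : ∀ {m} → Word m → ℕ
  weight {m} c = length (filterᵇ (λ α → not ⌊ c α ≟ 0# ⌋) (𝔄 m))

  InT : ∀ {m} → Vector m → Word m → Set
  InT δ c = InHamming c × weight c ≡ 3 × c δ ≡ 1#

  data InSpan {m : ℕ} (S : Word m → Set) : Word m → Set where
    span-zero : ∀ c → (∀ α → inA α ≡ true → c α ≡ 0#) → InSpan S c
    span-step : ∀ c a t c′ → S t → InSpan S c′ →
                (∀ α → inA α ≡ true → c α ≡ a * t α + c′ α) → InSpan S c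

  InR : ∀ {m} → Vector m → Word m → Set
  InR δ = InSpan (InT δ)

  IsLinear : ∀ {m} → (Vector m → Carrier) → Set
  IsLinear l = (∀ u v → l (u ⊕ v) ≡ l u + l v) × (∀ a v → l (a · v) ≡ a * l v)

  Independent : ∀ {m} → Vector m → Vector m → Set
  Independent u w = ∀ a b → (a · u) ⊕ (b · w) ≡ 0ᵛ → (a ≡ 0#) × (b ≡ 0#)

  inPlane : ∀ {m} → Vector m → Vector m → Vector m → Bool
  inPlane u w v = any (λ a → any (λ b → ⌊ ≡-dec _≟_ ((a · u) ⊕ (b · w)) v ⌋) elements) elements

  line : ∀ {m} → Vector m → Vector m → List (Vector m)
  line {m} u w = filterᵇ (inPlane u w) (𝔄 m)

module Submission where

-- Let L be a line through δ, i.e. L = 𝔄 ∩ P for a plane P ∋ δ, and let l be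
-- linear with l(δ) = 0.  The map c ↦ Σ_{α ∈ L} c_α l(α) is linear in c, so it
-- suffices to show that it vanishes on every generator t ∈ T_δ.  For such t it
-- equals l(s_L), where s_L = Σ_{α ∈ L} t_α α is the part of the syndrome of t
-- coming from the line.  Splitting 𝔄 into L and its complement N gives
-- s_L + s_N = 0 and 3 = |supp t ∩ L| + |supp t ∩ N| with δ ∈ supp t ∩ L.  Hence
--   * |supp t ∩ L| = 1: then s_L = t_δ δ, and l(s_L) = 0;
--   * |supp t ∩ N| = 0: then s_N = 0, so s_L = 0;
--   * |supp t ∩ N| = 1, supported at β ∉ P: impossible, since t_β β = -s_L ∈ P.
-- The file first develops F^m as a vector space (linear maps, subspaces, the
-- plane spanned by two vectors), then weighted sums over lists of points
-- together with their supports and partitions, then the fact that functionals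
-- linear on 𝔄-words annihilate spans.

open import Defs
open import Data.Nat using (ℕ; _≤_; zero; suc) renaming (_+_ to _+ℕ_)
open import Data.Nat.Properties using (+-suc)
open import Data.Bool using (Bool; true; false; not; T; T?)
open import Data.Bool.Properties using (T-≡)
open import Data.List using (List; []; _∷_; [_]; map; filterᵇ; length)
open import Data.List.Relation.Unary.Any using (here; there; satisfied)
open import Data.List.Relation.Unary.Any.Properties using (any⁺; any⁻)
open import Data.List.Membership.Propositional using (_∈_; lose)
open import Data.List.Membership.Propositional.Properties
  using (∈-filter⁺; ∈-filter⁻; ∈-map⁺; ∈-concat⁺′)
open import Data.Vec using ([]; _∷_)
import Data.Vec.Properties as Vecₚ
open import Data.Product using (∃; ∃₂; _×_; _,_; proj₁; proj₂)
open import Data.Sum using (_⊎_; inj₁; inj₂)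
open import Data.Empty using (⊥-elim)
open import Function using (_∘_; Equivalence)
open import Relation.Nullary using (¬_; yes; no)
open import Relation.Nullary.Decidable using (⌊_⌋; toWitness; fromWitness; toWitnessFalse; fromWitnessFalse)
open import Relation.Binary.PropositionalEquality
  using (_≡_; _≢_; refl; sym; trans; cong; cong₂; subst; module ≡-Reasoning)
open import Algebra.Bundles using (CommutativeRing)
import Algebra.Properties.Ring as RingProperties
import Algebra.Properties.CommutativeSemigroup as CommutativeSemigroupProperties

T⇒≡true : ∀ {b} → T b → b ≡ true
T⇒≡true = Equivalence.to T-≡

≡true⇒T : ∀ {b} → b ≡ true → T b
≡true⇒T = Equivalence.from T-≡

T-not⇒¬T : ∀ {b} → T (not b) → ¬ T b
T-not⇒¬T {true}  ()
T-not⇒¬T {false} _ ()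

length≡0⇒[] : ∀ {A : Set} (ys : List A) → length ys ≡ 0 → ys ≡ []
length≡0⇒[] [] refl = refl

length≡1⇒singleton : ∀ {A : Set} (ys : List A) → length ys ≡ 1 → ∃ λ y → ys ≡ [ y ]
length≡1⇒singleton (y ∷ []) refl = y , refl

∈⇒length≢0 : ∀ {A : Set} {x : A} {ys} → x ∈ ys → length ys ≢ 0
∈⇒length≢0 (here _)  ()
∈⇒length≢0 (there _) ()

length-filter-partition : ∀ {A : Set} (r p : A → Bool) xs →
  length (filterᵇ r xs) ≡ length (filterᵇ r (filterᵇ p xs)) +ℕ length (filterᵇ r (filterᵇ (not ∘ p) xs))
length-filter-partition r p [] = refl
length-filter-partition r p (x ∷ xs) with p x
... | true with r x
...   | true  = cong suc (length-filter-partition r p xs)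
...   | false = length-filter-partition r p xs
length-filter-partition r p (x ∷ xs) | false with r x
...   | true  = trans (cong suc (length-filter-partition r p xs)) (sym (+-suc _ _))
...   | false = length-filter-partition r p xs

split-three : ∀ a b → a +ℕ b ≡ 3 → a ≢ 0 → a ≡ 1 ⊎ b ≡ 1 ⊎ b ≡ 0
split-three zero b             _  a≢0 = ⊥-elim (a≢0 refl)
split-three 1    b             _  _   = inj₁ refl
split-three 2    1             _  _   = inj₂ (inj₁ refl)
split-three 3    0             _  _   = inj₂ (inj₂ refl)
split-three 2    0             ()
split-three 2    (suc (suc _)) ()
split-three 3    (suc _)       ()
split-three (suc (suc (suc (suc _)))) _ ()

module Lines (𝔽 : FiniteField) where
  open FiniteField 𝔽
  open Hamming 𝔽
  open ≡-Reasoning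

  ring : CommutativeRing _ _
  ring = record { isCommutativeRing = isCommutativeRing }

  open CommutativeRing ring
    using (+-assoc; +-comm; +-identityˡ; +-identityʳ; *-assoc; *-comm;
           *-identityˡ; distribˡ; distribʳ; zeroˡ; zeroʳ; +-commutativeSemigroup)
  open RingProperties (CommutativeRing.ring ring) using (-1*x≈-x; +-inverseʳ-unique)
  open CommutativeSemigroupProperties +-commutativeSemigroup using (interchange)

  ⊕-assoc : ∀ {m} (x y z : Vector m) → (x ⊕ y) ⊕ z ≡ x ⊕ (y ⊕ z)
  ⊕-assoc = Vecₚ.zipWith-assoc +-assoc

  ⊕-comm : ∀ {m} (x y : Vector m) → x ⊕ y ≡ y ⊕ x
  ⊕-comm = Vecₚ.zipWith-comm +-comm

  ⊕-identityˡ : ∀ {m} (x : Vector m) → 0ᵛ ⊕ x ≡ x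
  ⊕-identityˡ = Vecₚ.zipWith-identityˡ +-identityˡ

  ⊕-identityʳ : ∀ {m} (x : Vector m) → x ⊕ 0ᵛ ≡ x
  ⊕-identityʳ = Vecₚ.zipWith-identityʳ +-identityʳ

  ⊕-interchange : ∀ {m} (x y z w : Vector m) → (x ⊕ y) ⊕ (z ⊕ w) ≡ (x ⊕ z) ⊕ (y ⊕ w)
  ⊕-interchange []       []       []       []       = refl
  ⊕-interchange (a ∷ x) (b ∷ y) (c ∷ z) (d ∷ w) =
    cong₂ _∷_ (interchange a b c d) (⊕-interchange x y z w)

  ·-zeroˡ : ∀ {m} (v : Vector m) → 0# · v ≡ 0ᵛ
  ·-zeroˡ v = trans (Vecₚ.map-cong zeroˡ v) (Vecₚ.map-const v 0#)

  ·-identityˡ : ∀ {m} (v : Vector m) → 1# · v ≡ v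
  ·-identityˡ v = trans (Vecₚ.map-cong *-identityˡ v) (Vecₚ.map-id v)

  ·-assoc : ∀ {m} a b (v : Vector m) → a · (b · v) ≡ (a * b) · v
  ·-assoc a b v = trans (sym (Vecₚ.map-∘ (a *_) (b *_) v)) (Vecₚ.map-cong (λ x → sym (*-assoc a b x)) v)

  ·-distribˡ-⊕ : ∀ {m} a (x y : Vector m) → a · (x ⊕ y) ≡ (a · x) ⊕ (a · y)
  ·-distribˡ-⊕ a []      []      = refl
  ·-distribˡ-⊕ a (b ∷ x) (c ∷ y) = cong₂ _∷_ (distribˡ a b c) (·-distribˡ-⊕ a x y)

  ·-distribʳ-+ : ∀ {m} a b (x : Vector m) → (a + b) · x ≡ (a · x) ⊕ (b · x)
  ·-distribʳ-+ a b []      = refl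
  ·-distribʳ-+ a b (c ∷ x) = cong₂ _∷_ (distribʳ c a b) (·-distribʳ-+ a b x)

  ⊕≡0⇒negation : ∀ {m} (x y : Vector m) → x ⊕ y ≡ 0ᵛ → y ≡ (- 1#) · x
  ⊕≡0⇒negation []      []      _ = refl
  ⊕≡0⇒negation (a ∷ x) (b ∷ y) e =
    cong₂ _∷_ (trans (+-inverseʳ-unique a b (Vecₚ.∷-injectiveˡ e)) (sym (-1*x≈-x a)))
              (⊕≡0⇒negation x y (Vecₚ.∷-injectiveʳ e))

  linear-0 : ∀ {m} (l : Vector m → Carrier) → IsLinear l → l 0ᵛ ≡ 0#
  linear-0 l (_ , l-scale) = begin
    l 0ᵛ          ≡⟨ cong l (sym (·-zeroˡ 0ᵛ)) ⟩
    l (0# · 0ᵛ)   ≡⟨ l-scale 0# 0ᵛ ⟩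
    0# * l 0ᵛ     ≡⟨ zeroˡ _ ⟩
    0#            ∎

  record Subspace {m} (P : Vector m → Set) : Set where
    field
      contains-0 : P 0ᵛ
      closed-⊕   : ∀ {x y} → P x → P y → P (x ⊕ y)
      closed-·   : ∀ a {x} → P x → P (a · x)

    cancel-· : ∀ {a x} → a ≢ 0# → P (a · x) → P x
    cancel-· {a} {x} a≢0 Pax with inverse a a≢0
    ... | a⁻¹ , aa⁻¹≡1 = subst P a⁻¹ax≡x (closed-· a⁻¹ Pax)
      where
      a⁻¹ax≡x : a⁻¹ · (a · x) ≡ x
      a⁻¹ax≡x = begin
        a⁻¹ · (a · x)  ≡⟨ ·-assoc a⁻¹ a x ⟩
        (a⁻¹ * a) · x  ≡⟨ cong (_· x) (trans (*-comm a⁻¹ a) aa⁻¹≡1) ⟩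
        1# · x         ≡⟨ ·-identityˡ x ⟩
        x              ∎

  Plane : ∀ {m} → Vector m → Vector m → Vector m → Set
  Plane u w v = ∃₂ λ a b → (a · u) ⊕ (b · w) ≡ v

  plane-subspace : ∀ {m} (u w : Vector m) → Subspace (Plane u w)
  plane-subspace u w = record
    { contains-0 = 0# , 0# , trans (cong₂ _⊕_ (·-zeroˡ u) (·-zeroˡ w)) (⊕-identityˡ 0ᵛ)
    ; closed-⊕   = λ { (a , b , refl) (a′ , b′ , refl) →
        a + a′ , b + b′ ,
        trans (cong₂ _⊕_ (·-distribʳ-+ a a′ u) (·-distribʳ-+ b b′ w))
              (⊕-interchange (a · u) (a′ · u) (b · w) (b′ · w)) }
    ; closed-·   = λ { k (a , b , refl) →
        k * a , k * b ,
        trans (cong₂ _⊕_ (sym (·-assoc k a u)) (sym (·-assoc k b w)))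
              (sym (·-distribˡ-⊕ k (a · u) (b · w))) }
    }

  inPlane⇒Plane : ∀ {m} (u w v : Vector m) → T (inPlane u w v) → Plane u w v
  inPlane⇒Plane u w v h with satisfied (any⁻ _ elements h)
  ... | a , ha with satisfied (any⁻ _ elements ha)
  ... | b , hb = a , b , toWitness hb

  Plane⇒inPlane : ∀ {m} (u w v : Vector m) → Plane u w v → T (inPlane u w v)
  Plane⇒inPlane u w v (a , b , e) =
    any⁺ _ (lose (elements-complete a) (any⁺ _ (lose (elements-complete b) (fromWitness e))))

  allVecs-complete : ∀ m (v : Vector m) → v ∈ allVecs m
  allVecs-complete zero    []      = here refl
  allVecs-complete (suc m) (x ∷ v) =
    ∈-concat⁺′ (∈-map⁺ (x ∷_) (allVecs-complete m v)) (∈-map⁺ _ (elements-complete x))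

  𝔄-complete : ∀ m (v : Vector m) → T (inA v) → v ∈ 𝔄 m
  𝔄-complete m v = ∈-filter⁺ (T? ∘ inA) (allVecs-complete m v)

  line⊆𝔄 : ∀ {m} {u w x : Vector m} → x ∈ line u w → inA x ≡ true
  line⊆𝔄 {m} x∈L = T⇒≡true (proj₂ (∈-filter⁻ (T? ∘ inA) {xs = allVecs m}
                                  (proj₁ (∈-filter⁻ (T? ∘ inPlane _ _) x∈L))))

  weightedSum : ∀ {m} → Word m → List (Vector m) → Vector m
  weightedSum t xs = sumV (map (λ α → t α · α) xs)

  pairing : ∀ {m} → Word m → (Vector m → Carrier) → List (Vector m) → Carrier
  pairing t l xs = sumF (map (λ α → t α * l α) xs)

  linear-weightedSum : ∀ {m} (l : Vector m → Carrier) → IsLinear l →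
    ∀ (t : Word m) xs → l (weightedSum t xs) ≡ pairing t l xs
  linear-weightedSum l lin t []       = linear-0 l lin
  linear-weightedSum l lin@(l-add , l-scale) t (x ∷ xs) = begin
    l ((t x · x) ⊕ weightedSum t xs)   ≡⟨ l-add _ _ ⟩
    l (t x · x) + l (weightedSum t xs) ≡⟨ cong₂ _+_ (l-scale (t x) x) (linear-weightedSum l lin t xs) ⟩
    t x * l x + pairing t l xs         ∎

  weightedSum-partition : ∀ {m} (t : Word m) (p : Vector m → Bool) xs →
    weightedSum t xs ≡ weightedSum t (filterᵇ p xs) ⊕ weightedSum t (filterᵇ (not ∘ p) xs)
  weightedSum-partition t p []       = sym (⊕-identityˡ 0ᵛ)
  weightedSum-partition t p (x ∷ xs) with p x
  ... | true  = trans (cong ((t x · x) ⊕_) (weightedSum-partition t p xs)) (sym (⊕-assoc _ _ _))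
  ... | false = begin
    (t x · x) ⊕ weightedSum t xs  ≡⟨ cong ((t x · x) ⊕_) (weightedSum-partition t p xs) ⟩
    (t x · x) ⊕ (sL ⊕ sN)         ≡⟨ sym (⊕-assoc _ sL sN) ⟩
    ((t x · x) ⊕ sL) ⊕ sN         ≡⟨ cong (_⊕ sN) (⊕-comm _ sL) ⟩
    (sL ⊕ (t x · x)) ⊕ sN         ≡⟨ ⊕-assoc sL _ sN ⟩
    sL ⊕ ((t x · x) ⊕ sN)         ∎
    where
    sL = weightedSum t (filterᵇ p xs)
    sN = weightedSum t (filterᵇ (not ∘ p) xs)

  isNonzero : ∀ {m} → Word m → Vector m → Bool
  isNonzero t α = not ⌊ t α ≟ 0# ⌋

  support : ∀ {m} → Word m → List (Vector m) → List (Vector m)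
  support t = filterᵇ (isNonzero t)

  ∈-support⁺ : ∀ {m} {t : Word m} {x} xs → x ∈ xs → t x ≢ 0# → x ∈ support t xs
  ∈-support⁺ xs x∈xs tx≢0 = ∈-filter⁺ (T? ∘ isNonzero _) x∈xs (fromWitnessFalse tx≢0)

  ∈-support⁻ : ∀ {m} {t : Word m} {x} xs → x ∈ support t xs → x ∈ xs × t x ≢ 0#
  ∈-support⁻ xs x∈s with ∈-filter⁻ (T? ∘ isNonzero _) {xs = xs} x∈s
  ... | x∈xs , nz = x∈xs , toWitnessFalse nz

  weightedSum-support : ∀ {m} (t : Word m) xs → weightedSum t xs ≡ weightedSum t (support t xs)
  weightedSum-support t []       = refl
  weightedSum-support t (x ∷ xs) with t x ≟ 0#
  ... | yes tx≡0 = begin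
    (t x · x) ⊕ weightedSum t xs  ≡⟨ cong (λ a → (a · x) ⊕ weightedSum t xs) tx≡0 ⟩
    (0# · x) ⊕ weightedSum t xs   ≡⟨ cong (_⊕ weightedSum t xs) (·-zeroˡ x) ⟩
    0ᵛ ⊕ weightedSum t xs         ≡⟨ ⊕-identityˡ _ ⟩
    weightedSum t xs              ≡⟨ weightedSum-support t xs ⟩
    weightedSum t (support t xs)  ∎
  ... | no _ = cong ((t x · x) ⊕_) (weightedSum-support t xs)

  weightedSum-empty-support : ∀ {m} (t : Word m) xs → length (support t xs) ≡ 0 → weightedSum t xs ≡ 0ᵛ
  weightedSum-empty-support t xs e =
    trans (weightedSum-support t xs) (cong (weightedSum t) (length≡0⇒[] (support t xs) e))

  weightedSum-singleton-support : ∀ {m} (t : Word m) xs {β} → support t xs ≡ [ β ] →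
    weightedSum t xs ≡ t β · β
  weightedSum-singleton-support t xs e =
    trans (weightedSum-support t xs) (trans (cong (weightedSum t) e) (⊕-identityʳ _))

  singleton-support-in-subspace : ∀ {m} {P : Vector m → Set} → Subspace P →
    (t : Word m) (xs : List (Vector m)) {β : Vector m} → support t xs ≡ [ β ] → P (weightedSum t xs) → P β
  singleton-support-in-subspace {P = P} P-sub t xs {β} e Psum =
    Subspace.cancel-· P-sub tβ≢0 (subst P (weightedSum-singleton-support t xs e) Psum)
    where
    tβ≢0 : t β ≢ 0#
    tβ≢0 = proj₂ (∈-support⁻ xs (subst (β ∈_) (sym e) (here refl)))

  weightedSum-in-subspace : ∀ {m} {P : Vector m → Set} → Subspace P →
    (t : Word m) (xs : List (Vector m)) → (∀ {x} → x ∈ xs → P x) → P (weightedSum t xs)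
  weightedSum-in-subspace P-sub t []       _    = Subspace.contains-0 P-sub
  weightedSum-in-subspace P-sub t (x ∷ xs) xs⊆P = Subspace.closed-⊕ P-sub
    (Subspace.closed-· P-sub (t x) (xs⊆P (here refl))) (weightedSum-in-subspace P-sub t xs (xs⊆P ∘ there))

  span-annihilator : ∀ {m} {S : Word m → Set} (φ : Word m → Carrier) →
    (∀ c → (∀ α → inA α ≡ true → c α ≡ 0#) → φ c ≡ 0#) →
    (∀ c a t c′ → (∀ α → inA α ≡ true → c α ≡ a * t α + c′ α) → φ c ≡ a * φ t + φ c′) →
    (∀ t → S t → φ t ≡ 0#) → ∀ c → InSpan S c → φ c ≡ 0#
  span-annihilator φ φ-zero φ-linear φ-S c (span-zero .c c≡0) = φ-zero c c≡0
  span-annihilator φ φ-zero φ-linear φ-S c (span-step .c a t c′ St c′∈ c≡) = begin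
    φ c             ≡⟨ φ-linear c a t c′ c≡ ⟩
    a * φ t + φ c′  ≡⟨ cong₂ (λ x y → a * x + y) (φ-S t St) (span-annihilator φ φ-zero φ-linear φ-S c′ c′∈) ⟩
    a * 0# + 0#     ≡⟨ +-identityʳ _ ⟩
    a * 0#          ≡⟨ zeroʳ a ⟩
    0#              ∎

  pairing-zero : ∀ {m} (c : Word m) l xs → (∀ {x} → x ∈ xs → c x ≡ 0#) → pairing c l xs ≡ 0#
  pairing-zero c l []       _   = refl
  pairing-zero c l (x ∷ xs) c≡0 = begin
    c x * l x + pairing c l xs ≡⟨ cong₂ _+_ (cong (_* l x) (c≡0 (here refl))) (pairing-zero c l xs (c≡0 ∘ there)) ⟩
    0# * l x + 0#              ≡⟨ +-identityʳ _ ⟩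
    0# * l x                   ≡⟨ zeroˡ (l x) ⟩
    0#                         ∎

  pairing-linear : ∀ {m} (c : Word m) a t c′ l xs → (∀ {x} → x ∈ xs → c x ≡ a * t x + c′ x) →
    pairing c l xs ≡ a * pairing t l xs + pairing c′ l xs
  pairing-linear c a t c′ l []       _  = sym (trans (+-identityʳ _) (zeroʳ a))
  pairing-linear c a t c′ l (x ∷ xs) c≡ = begin
    c x * l x + pairing c l xs                         ≡⟨ cong₂ _+_ (cong (_* l x) (c≡ (here refl)))
                                                                   (pairing-linear c a t c′ l xs (c≡ ∘ there)) ⟩
    (a * t x + c′ x) * l x + (a * S + S′)              ≡⟨ cong (_+ (a * S + S′)) (distribʳ (l x) (a * t x) (c′ x)) ⟩
    (a * t x * l x + c′ x * l x) + (a * S + S′)        ≡⟨ cong (λ z → (z + c′ x * l x) + (a * S + S′)) (*-assoc a (t x) (l x)) ⟩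
    (a * (t x * l x) + c′ x * l x) + (a * S + S′)      ≡⟨ interchange _ _ _ _ ⟩
    (a * (t x * l x) + a * S) + (c′ x * l x + S′)      ≡⟨ cong (_+ (c′ x * l x + S′)) (sym (distribˡ a (t x * l x) S)) ⟩
    a * (t x * l x + S) + (c′ x * l x + S′)            ∎
    where
    S  = pairing t l xs
    S′ = pairing c′ l xs

  line-syndrome : ∀ {m} (δ : Vector m) → inA δ ≡ true → (t : Word m) → InT δ t →
    (u w : Vector m) → inPlane u w δ ≡ true →
    weightedSum t (line u w) ≡ δ ⊎ weightedSum t (line u w) ≡ 0ᵛ
  line-syndrome {m} δ δ∈𝔄 t (t∈H , weight≡3 , tδ≡1) u w δ∈P =
    by-cases (split-three (length (support t L)) (length (support t N)) weight-splits (∈⇒length≢0 δ∈suppL))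
    where
    L N : List (Vector m)
    L = line u w
    N = filterᵇ (not ∘ inPlane u w) (𝔄 m)

    weight-splits : length (support t L) +ℕ length (support t N) ≡ 3
    weight-splits = trans (sym (length-filter-partition (isNonzero t) (inPlane u w) (𝔄 m))) weight≡3

    δ∈suppL : δ ∈ support t L
    δ∈suppL = ∈-support⁺ L (∈-filter⁺ (T? ∘ inPlane u w) (𝔄-complete m δ (≡true⇒T δ∈𝔄)) (≡true⇒T δ∈P))
                         (λ tδ≡0 → 0≢1 (trans (sym tδ≡0) tδ≡1))

    sL⊕sN≡0 : weightedSum t L ⊕ weightedSum t N ≡ 0ᵛ
    sL⊕sN≡0 = trans (sym (weightedSum-partition t (inPlane u w) (𝔄 m))) t∈H

    -- s_L lies in the plane, hence so does s_N = -s_L.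
    sN∈P : Plane u w (weightedSum t N)
    sN∈P = subst (Plane u w) (sym (⊕≡0⇒negation _ _ sL⊕sN≡0))
                 (Subspace.closed-· (plane-subspace u w) (- 1#)
                   (weightedSum-in-subspace (plane-subspace u w) t L
                     (λ x∈L → inPlane⇒Plane u w _ (proj₂ (∈-filter⁻ (T? ∘ inPlane u w) {xs = 𝔄 m} x∈L)))))

    N∌P : ∀ {x} → x ∈ N → ¬ Plane u w x
    N∌P x∈N x∈P = T-not⇒¬T (proj₂ (∈-filter⁻ (T? ∘ (not ∘ inPlane u w)) {xs = 𝔄 m} x∈N)) (Plane⇒inPlane u w _ x∈P)

    by-cases : length (support t L) ≡ 1 ⊎ length (support t N) ≡ 1 ⊎ length (support t N) ≡ 0 →
               weightedSum t L ≡ δ ⊎ weightedSum t L ≡ 0ᵛ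
    by-cases (inj₁ |suppL|≡1) with length≡1⇒singleton (support t L) |suppL|≡1
    ... | β , suppL≡[β] with subst (δ ∈_) suppL≡[β] δ∈suppL
    ... | here refl = inj₁ (begin
      weightedSum t L  ≡⟨ weightedSum-singleton-support t L suppL≡[β] ⟩
      t δ · δ          ≡⟨ cong (_· δ) tδ≡1 ⟩
      1# · δ           ≡⟨ ·-identityˡ δ ⟩
      δ                ∎)
    by-cases (inj₂ (inj₁ |suppN|≡1)) with length≡1⇒singleton (support t N) |suppN|≡1
    ... | β , suppN≡[β] =
      ⊥-elim (N∌P (proj₁ (∈-support⁻ N (subst (β ∈_) (sym suppN≡[β]) (here refl))))
                  (singleton-support-in-subspace (plane-subspace u w) t N suppN≡[β] sN∈P))
    by-cases (inj₂ (inj₂ |suppN|≡0)) = inj₂ (begin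
      weightedSum t L                      ≡⟨ sym (⊕-identityʳ _) ⟩
      weightedSum t L ⊕ 0ᵛ                 ≡⟨ cong (weightedSum t L ⊕_) (sym (weightedSum-empty-support t N |suppN|≡0)) ⟩
      weightedSum t L ⊕ weightedSum t N    ≡⟨ sL⊕sN≡0 ⟩
      0ᵛ                                   ∎)

lemma2 : (𝔽 : FiniteField) → let open Hamming 𝔽 in
    (m : ℕ) → 2 ≤ m →
    (δ : Vector m) → inA δ ≡ true →
    (c : Word m) → InR δ c →
    (l : Vector m → FiniteField.Carrier 𝔽) → IsLinear l → l δ ≡ FiniteField.0# 𝔽 →
    (u w : Vector m) → Independent u w → inPlane u w δ ≡ true →
    sumF (map (λ α → FiniteField._*_ 𝔽 (c α) (l α)) (line u w)) ≡ FiniteField.0# 𝔽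
lemma2 𝔽 m _ δ δ∈𝔄 c c∈R l lin lδ≡0 u w _ δ∈P =
  span-annihilator (λ d → pairing d l L)
    (λ d d≡0 → pairing-zero d l L (λ x∈L → d≡0 _ (line⊆𝔄 x∈L)))
    (λ d a t d′ d≡ → pairing-linear d a t d′ l L (λ x∈L → d≡ _ (line⊆𝔄 x∈L)))
    generator-pairing c c∈R
  where
  open FiniteField 𝔽
  open Hamming 𝔽
  open Lines 𝔽
  L : List (Vector m)
  L = line u w

  -- On a generator t ∈ T_δ the pairing is l of the line syndrome, i.e. l δ or l 0.
  generator-pairing : ∀ t → InT δ t → pairing t l L ≡ 0#
  generator-pairing t t∈T with line-syndrome δ δ∈𝔄 t t∈T u w δ∈P
  ... | inj₁ sL≡δ = trans (sym (linear-weightedSum l lin t L)) (trans (cong l sL≡δ) lδ≡0)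
  ... | inj₂ sL≡0 = trans (sym (linear-weightedSum l lin t L)) (trans (cong l sL≡0) (linear-0 l lin))
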